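{- Let $\mathfrak{X}=(X,\{R_i\}_{i=0}^5)$ be the association scheme of the 1-skeleton of the dodecahedron ($|X|=20$, $(x,y)\in R_i$ iff the graph distance between $x$ and $y$ is $i$). Let its primitive idempotents $E_0,\dots,E_5$ be ordered so that $A_1E_k=\theta_kE_k$ with $(\theta_0,\dots,\theta_5)=(3,\sqrt5,1,0,-2,-\sqrt5)$, where $A_1$ is the adjacency matrix of $R_1$. Relabel them by $\mathcal D^\ast=\{(0,0),(0,1),(0,2),(0,3),(1,0),(1,1)\}$ via $E_{00}=E_0$, $E_{01}=E_1$, $E_{02}=E_2$, $E_{10}=E_3$, $E_{11}=E_4$, $E_{03}=E_5$. Then $\mathfrak X$ is a bivariate $Q$-polynomial association scheme on $\mathcal D^\ast$ with respect to the graded lexicographic order.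
   Context: Primitive idempotents of a commutative association scheme are the primitive idempotents of its Bose–Mesner algebra (the span of its adjacency matrices); $\circ$ denotes the entrywise (Hadamard) product, and $E^{\circ 0}$ is the all-ones matrix. Notation: $\epsilon_i\in\mathbb N^\ell$ is the $i$-th unit vector; for $\alpha=(n_1,\dots,n_\ell)$, $\mathbf x^\alpha=x_1^{n_1}\cdots x_\ell^{n_\ell}$, $|\alpha|=\sum n_i$. A monomial order is a total well-order $\le$ on $\mathbb N^\ell$ with $\alpha\le\beta\Rightarrow\alpha+\gamma\le\beta+\gamma$. Graded lexicographic order: $\alpha\le_{\mathrm{grlex}}\beta$ iff $|\alpha|<|\beta|$, or $|\alpha|=|\beta|$ and either $\alpha=\beta$ or the leftmost nonzero entry of $\alpha-\beta$ is negative. The multidegree of a nonzero polynomial is the $\le$-largest exponent appearing with nonzero coefficient. Definition: Let $\mathcal D^\ast\subset\mathbb N^\ell$ contain $\epsilon_1,\dots,\epsilon_\ell$ and $\le$ a monomial order. A commutative association scheme on $X$ is $\ell$-variate $Q$-polynomial on $\mathcal D^\ast$ w.r.t. $\le$ if (i) $\mathcal D^\ast$ is closed under decreasing coordinates (if $(n_k)\in\mathcal D^\ast$ and $0\le m_k\le n_k$ then $(m_k)\in\mathcal D^\ast$); (ii) its primitive idempotents are labeled bijectively $\{E_\alpha\}_{\alpha\in\mathcal D^\ast}$ so that for each $\alpha$, $|X|E_\alpha=v^\ast_\alpha(|X|E_{\epsilon_1},\dots,|X|E_{\epsilon_\ell})$ with products taken as Hadamard products, for a polynomial $v^\ast_\alpha$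 of multidegree $\alpha$ w.r.t. $\le$ all of whose monomials $\mathbf x^\beta$ have $\beta\in\mathcal D^\ast$; (iii) for each $i$ and $\alpha=(n_1,\dots,n_\ell)\in\mathcal D^\ast$, $E_{\epsilon_i}\circ E_{\epsilon_1}^{\circ n_1}\circ\cdots\circ E_{\epsilon_\ell}^{\circ n_\ell}$ is a linear combination of $\{E_{\epsilon_1}^{\circ m_1}\circ\cdots\circ E_{\epsilon_\ell}^{\circ m_\ell}\mid (m_1,\dots,m_\ell)\in\mathcal D^\ast,\ (m_1,\dots,m_\ell)\le\alpha+\epsilon_i\}$. "Bivariate" means $\ell=2$. -}

module Defs where

open import Data.Nat as ℕ using (ℕ; zero; suc; _%_)
import Data.Nat.Properties as ℕP
open import Data.Integer using (+_)
open import Data.Rational as ℚ using (ℚ; _/_; 0ℚ; 1ℚ)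
open import Data.Fin using (Fin; toℕ; fromℕ<) renaming (zero to fz; suc to fs)
open import Data.Fin.Properties using (_≟_)
open import Data.Bool using (Bool; true; false; _∧_; _∨_; not; if_then_else_)
open import Data.List using (List; []; _∷_; foldr)
open import Data.List.Membership.Propositional using (_∈_)
open import Data.Product using (_×_; _,_; ∃; Σ)
open import Data.Sum using (_⊎_)
open import Relation.Nullary using (¬_; does)
open import Relation.Binary.PropositionalEquality using (_≡_)

record K : Set where
  constructor _+√5·_
  field
    re im : ℚ
infix 5 _+√5·_

infixl 6 _+K_
infixl 7 _*K_

_+K_ : K → K → K
(a +√5· b) +K (c +√5· d) = (a ℚ.+ c) +√5· (b ℚ.+ d)

_*K_ : K → K → K
(a +√5· b) *K (c +√5· d) =
  ((a ℚ.* c) ℚ.+ ((+ 5 / 1) ℚ.* (b ℚ.* d))) +√5· ((a ℚ.* d) ℚ.+ (b ℚ.* c))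

-K_ : K → K
-K (a +√5· b) = (ℚ.- a) +√5· (ℚ.- b)

0K 1K √5 : K
0K = 0ℚ +√5· 0ℚ
1K = 1ℚ +√5· 0ℚ
√5 = 0ℚ +√5· 1ℚ

natK : ℕ → K
natK n = (+ n / 1) +√5· 0ℚ

N : ℕ
N = 20

X : Set
X = Fin N

Mat : Set
Mat = X → X → K

_≈M_ : Mat → Mat → Set
M ≈M M' = ∀ x y → M x y ≡ M' x y

infix 4 _≈M_

zeroM oneM idM : Mat
zeroM _ _ = 0K
oneM _ _ = 1K
idM x y = if does (x ≟ y) then 1K else 0K

_+M_ : Mat → Mat → Mat
(M +M M') x y = M x y +K M' x y

_·s_ : K → Mat → Mat
(c ·s M) x y = c *K M x y

sumFin : ∀ {n} → (Fin n → K) → K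
sumFin {zero} f = 0K
sumFin {suc n} f = f fz +K sumFin (λ i → f (fs i))

sumFinM : ∀ {n} → (Fin n → Mat) → Mat
sumFinM {zero} f = zeroM
sumFinM {suc n} f = f fz +M sumFinM (λ i → f (fs i))

_·M_ : Mat → Mat → Mat
(M ·M M') x y = sumFin (λ z → M x z *K M' z y)

_∘M_ : Mat → Mat → Mat
(M ∘M M') x y = M x y *K M' x y

hpow : Mat → ℕ → Mat
hpow M zero = oneM
hpow M (suc n) = M ∘M hpow M n

-- The dodecahedron graph, as the generalized Petersen graph GP(10,2):
-- outer vertices u_i = i (i < 10), inner vertices v_i = 10 + i;
-- edges u_i ~ u_{i+1}, u_i ~ v_i, v_i ~ v_{i+2} (indices mod 10).

adjℕ : ℕ → ℕ → Bool
adjℕ a b =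
  (ℕ._<ᵇ_ a 10 ∧ ℕ._<ᵇ_ b 10 ∧ (ℕ._≡ᵇ_ b ((a ℕ.+ 1) % 10) ∨ ℕ._≡ᵇ_ a ((b ℕ.+ 1) % 10)))
  ∨ (ℕ._<ᵇ_ a 10 ∧ ℕ._≡ᵇ_ b (a ℕ.+ 10))
  ∨ (ℕ._<ᵇ_ b 10 ∧ ℕ._≡ᵇ_ a (b ℕ.+ 10))
  ∨ (not (ℕ._<ᵇ_ a 10) ∧ not (ℕ._<ᵇ_ b 10) ∧
      (ℕ._≡ᵇ_ (b ℕ.∸ 10) (((a ℕ.∸ 10) ℕ.+ 2) % 10) ∨ ℕ._≡ᵇ_ (a ℕ.∸ 10) (((b ℕ.∸ 10) ℕ.+ 2) % 10)))

adj : X → X → Bool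
adj x y = adjℕ (toℕ x) (toℕ y)

anyX : (X → Bool) → Bool
anyX p = go N (λ i → p i)
  where
  go : (n : ℕ) → (Fin n → Bool) → Bool
  go zero f = false
  go (suc n) f = f fz ∨ go n (λ i → f (fs i))

reach : ℕ → X → X → Bool
reach zero x y = does (x ≟ y)
reach (suc n) x y = reach n x y ∨ anyX (λ z → adj z y ∧ reach n x z)

distIs : ℕ → X → X → Bool
distIs zero x y = reach zero x y
distIs (suc i) x y = reach (suc i) x y ∧ not (reach i x y)

A : ℕ → Mat
A i x y = if distIs i x y then 1K else 0K

InBM : Mat → Set
InBM M = ∃ λ (c : Fin 6 → K) → M ≈M sumFinM (λ i → c i ·s A (toℕ i))

-- E_0,…,E_5 are the primitive idempotents of the Bose–Mesner algebra:
-- members of the algebra, nonzero, pairwise orthogonal idempotents,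
-- summing to the identity (the algebra has dimension 6).
IsPrimitiveIdempotents : (Fin 6 → Mat) → Set
IsPrimitiveIdempotents E =
  (∀ k → InBM (E k)) ×
  (∀ k → ¬ (E k ≈M zeroM)) ×
  (∀ j k → E j ·M E k ≈M (if does (j ≟ k) then E k else zeroM)) ×
  (sumFinM E ≈M idM)

θ : Fin 6 → K
θ fz = natK 3
θ (fs fz) = √5
θ (fs (fs fz)) = 1K
θ (fs (fs (fs fz))) = 0K
θ (fs (fs (fs (fs fz)))) = -K natK 2
θ (fs (fs (fs (fs (fs fz))))) = -K √5

ℕ² : Set
ℕ² = ℕ × ℕ

ε₁ ε₂ : ℕ²
ε₁ = (1 , 0)
ε₂ = (0 , 1)

_+²_ : ℕ² → ℕ² → ℕ²
(a , b) +² (c , d) = (a ℕ.+ c , b ℕ.+ d)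

_≤grlex_ : ℕ² → ℕ² → Set
(a₁ , a₂) ≤grlex (b₁ , b₂) =
  (a₁ ℕ.+ a₂ ℕ.< b₁ ℕ.+ b₂) ⊎
  ((a₁ ℕ.+ a₂ ≡ b₁ ℕ.+ b₂) ×
    (((a₁ , a₂) ≡ (b₁ , b₂)) ⊎ (a₁ ℕ.< b₁) ⊎ ((a₁ ≡ b₁) × (a₂ ℕ.< b₂))))

sumList : List ℕ² → (ℕ² → Mat) → Mat
sumList [] f = zeroM
sumList (β ∷ βs) f = f β +M sumList βs f

hmono : Mat → Mat → ℕ² → Mat
hmono M₁ M₂ (m₁ , m₂) = hpow M₁ m₁ ∘M hpow M₂ m₂

-- The scheme (with idempotents labelled by E on the finite set D*, given
-- as a duplicate-free list D) is bivariate Q-polynomial on D* w.r.t. _≤_.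
IsBivariateQPolynomial : (D : List ℕ²) → (ℕ² → ℕ² → Set) → (ℕ² → Mat) → Set
IsBivariateQPolynomial D _≤_ E =
  (ε₁ ∈ D) × (ε₂ ∈ D) ×
  (∀ n₁ n₂ m₁ m₂ → (n₁ , n₂) ∈ D → m₁ ℕ.≤ n₁ → m₂ ℕ.≤ n₂ → (m₁ , m₂) ∈ D) ×
  -- (ii) |X| E_α = v*_α(|X|E_ε₁, |X|E_ε₂), v*_α of multidegree α, support in D
  (∀ α → α ∈ D → Σ (ℕ² → K) λ c →
      ¬ (c α ≡ 0K) ×
      (∀ β → β ∈ D → ¬ (c β ≡ 0K) → β ≤ α) ×
      (natK N ·s E α ≈M
        sumList D (λ β → c β ·s hmono (natK N ·s E ε₁) (natK N ·s E ε₂) β))) ×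
  (∀ i → (i ≡ ε₁ ⊎ i ≡ ε₂) → ∀ α → α ∈ D → Σ (ℕ² → K) λ d →
      (∀ β → β ∈ D → ¬ (d β ≡ 0K) → β ≤ (α +² i)) ×
      (E i ∘M hmono (E ε₁) (E ε₂) α ≈M
        sumList D (λ β → d β ·s hmono (E ε₁) (E ε₂) β)))

Dstar : List ℕ²
Dstar = (0 , 0) ∷ (0 , 1) ∷ (0 , 2) ∷ (0 , 3) ∷ (1 , 0) ∷ (1 , 1) ∷ []

-- E_00 = E_0, E_01 = E_1, E_02 = E_2, E_10 = E_3, E_11 = E_4, E_03 = E_5
-- (labels outside D* are unused; sent to the zero matrix)
relabel : (Fin 6 → Mat) → ℕ² → Mat
relabel E (0 , 0) = E fz
relabel E (0 , 1) = E (fs fz)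
relabel E (0 , 2) = E (fs (fs fz))
relabel E (1 , 0) = E (fs (fs (fs fz)))
relabel E (1 , 1) = E (fs (fs (fs (fs fz))))
relabel E (0 , 3) = E (fs (fs (fs (fs (fs fz)))))
relabel E _ = zeroM

module Submission where

-- The eigenvalues θ₀,…,θ₅ of A₁ are pairwise distinct, and a left eigenvector of
-- A₁ is orthogonal to a right eigenvector for a different eigenvalue.  Hence
-- orthogonal idempotents Eₖ summing to I with A₁Eₖ = θₖEₖ coincide with any
-- family Fₖ satisfying ΣFₖ = I and A₁Fₖ = θₖFₖ; such Fₖ, with entries depending
-- only on the distance between the two vertices, are written down and checked by
-- computation in ℚ(√5).  Hadamard products of functions of the distance are
-- computed distance by distance, so conditions (ii) and (iii), with explicitly
-- given coefficients, become identities between functions on the six distance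
-- classes, which are again checked by evaluation.

open import Defs
open import Data.Nat as ℕ using (ℕ; zero; suc; s≤s)
open import Data.Nat.Properties using (allUpTo?)
open import Data.Integer using (ℤ; +_)
open import Data.Rational as ℚ using (ℚ; _/_; 0ℚ; 1ℚ)
import Data.Rational.Properties as ℚ
open import Data.Rational.Solver using (module +-*-Solver)
open import Data.Fin using (Fin) renaming (zero to fz; suc to fs)
open import Data.Fin.Patterns using (0F; 1F; 2F; 3F; 4F; 5F)
open import Data.Fin.Properties using (_≟_; suc-injective; all?)
open import Data.Bool using (if_then_else_)
open import Data.Empty using (⊥-elim)
open import Data.List using (List; []; _∷_; foldr)
open import Data.List.Relation.Unary.All as All using (All)
open import Data.List.Relation.Unary.Any using (here; there)
open import Data.List.Membership.Propositional using (_∈_)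
open import Data.Product using (Σ; Σ-syntax; _×_; _,_; proj₁; proj₂)
open import Data.Product.Properties using (≡-dec)
open import Data.List.Membership.DecPropositional (≡-dec ℕ._≟_ ℕ._≟_) using (_∈?_)
open import Data.Sum using (_⊎_; inj₁; inj₂)
open import Data.Vec using (Vec; []; _∷_; lookup; replicate)
open import Function using (_∘′_)
open import Relation.Nullary using (¬_; ¬?; does)
open import Relation.Nullary.Decidable using (Dec; map′; from-yes; dec-true; dec-false; _⊎-dec_; _×-dec_)
open import Relation.Binary.Bundles using (Setoid)
open import Relation.Binary.Definitions using (Decidable; DecidableEquality)
open import Relation.Binary.PropositionalEquality
open import Algebra.Bundles using (CommutativeRing; Semiring)
open import Algebra.Structures {A = K} _≡_ using (IsCommutativeRing)
open import Algebra.Solver.Ring.AlmostCommutativeRing using (fromCommutativeRing)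
import Algebra.Solver.Ring.Simple as RingSolver
import Algebra.Properties.Semiring.Sum as SemiringSum
import Algebra.Properties.CommutativeSemigroup as CommutativeSemigroupProperties
import Algebra.Definitions.RawSemiring as RawSemiringDefinitions

infix 4 _≟K_
_≟K_ : DecidableEquality K
(a +√5· b) ≟K (c +√5· d) =
  map′ (λ (p , q) → cong₂ _+√5·_ p q) (λ { refl → refl , refl }) ((a ℚ.≟ c) ×-dec (b ℚ.≟ d))

K-isCommutativeRing : IsCommutativeRing _+K_ _*K_ -K_ 0K 1K
K-isCommutativeRing = record
  { isRing = record
    { +-isAbelianGroup = record
      { isGroup = record
        { isMonoid = record
          { isSemigroup = record
            { isMagma = record { isEquivalence = isEquivalence ; ∙-cong = cong₂ _+K_ }
            ; assoc = +-assoc }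
          ; identity = +-identityˡ , +-identityʳ }
        ; inverse = -‿inverseˡ , -‿inverseʳ
        ; ⁻¹-cong = cong -K_ }
      ; comm = +-comm }
    ; *-cong = cong₂ _*K_
    ; *-assoc = *-assoc
    ; *-identity = *-identityˡ , *-identityʳ
    ; distrib = distribˡ , distribʳ }
  ; *-comm = *-comm }
  where
  open +-*-Solver
  five : ℚ
  five = + 5 / 1

  +-assoc : ∀ x y z → (x +K y) +K z ≡ x +K (y +K z)
  +-assoc (a +√5· a') (b +√5· b') (c +√5· c') = cong₂ _+√5·_
    (solve 3 (λ x y z → (x :+ y) :+ z := x :+ (y :+ z)) refl a b c)
    (solve 3 (λ x y z → (x :+ y) :+ z := x :+ (y :+ z)) refl a' b' c')

  +-comm : ∀ x y → x +K y ≡ y +K x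
  +-comm (a +√5· a') (b +√5· b') = cong₂ _+√5·_ (ℚ.+-comm a b) (ℚ.+-comm a' b')

  +-identityˡ : ∀ x → 0K +K x ≡ x
  +-identityˡ (a +√5· a') = cong₂ _+√5·_ (ℚ.+-identityˡ a) (ℚ.+-identityˡ a')

  +-identityʳ : ∀ x → x +K 0K ≡ x
  +-identityʳ (a +√5· a') = cong₂ _+√5·_ (ℚ.+-identityʳ a) (ℚ.+-identityʳ a')

  -‿inverseˡ : ∀ x → (-K x) +K x ≡ 0K
  -‿inverseˡ (a +√5· a') = cong₂ _+√5·_ (ℚ.+-inverseˡ a) (ℚ.+-inverseˡ a')

  -‿inverseʳ : ∀ x → x +K (-K x) ≡ 0K
  -‿inverseʳ (a +√5· a') = cong₂ _+√5·_ (ℚ.+-inverseʳ a) (ℚ.+-inverseʳ a')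

  *-comm : ∀ x y → x *K y ≡ y *K x
  *-comm (a +√5· a') (b +√5· b') = cong₂ _+√5·_
    (solve 4 (λ x x' y y' → x :* y :+ con five :* (x' :* y') := y :* x :+ con five :* (y' :* x')) refl a a' b b')
    (solve 4 (λ x x' y y' → x :* y' :+ x' :* y := y :* x' :+ y' :* x) refl a a' b b')

  *-assoc : ∀ x y z → (x *K y) *K z ≡ x *K (y *K z)
  *-assoc (a +√5· a') (b +√5· b') (c +√5· c') = cong₂ _+√5·_
    (solve 6 (λ x x' y y' z z' →
        (x :* y :+ con five :* (x' :* y')) :* z :+ con five :* ((x :* y' :+ x' :* y) :* z')
     := x :* (y :* z :+ con five :* (y' :* z')) :+ con five :* (x' :* (y :* z' :+ y' :* z))) refl a a' b b' c c')
    (solve 6 (λ x x' y y' z z' →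
        (x :* y :+ con five :* (x' :* y')) :* z' :+ (x :* y' :+ x' :* y) :* z
     := x :* (y :* z' :+ y' :* z) :+ x' :* (y :* z :+ con five :* (y' :* z'))) refl a a' b b' c c')

  *-identityˡ : ∀ x → 1K *K x ≡ x
  *-identityˡ (a +√5· a') = cong₂ _+√5·_
    (solve 2 (λ x x' → con 1ℚ :* x :+ con five :* (con 0ℚ :* x') := x) refl a a')
    (solve 2 (λ x x' → con 1ℚ :* x' :+ con 0ℚ :* x := x') refl a a')

  *-identityʳ : ∀ x → x *K 1K ≡ x
  *-identityʳ x = trans (*-comm x 1K) (*-identityˡ x)

  distribˡ : ∀ x y z → x *K (y +K z) ≡ x *K y +K x *K z
  distribˡ (a +√5· a') (b +√5· b') (c +√5· c') = cong₂ _+√5·_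
    (solve 6 (λ x x' y y' z z' →
        x :* (y :+ z) :+ con five :* (x' :* (y' :+ z'))
     := (x :* y :+ con five :* (x' :* y')) :+ (x :* z :+ con five :* (x' :* z'))) refl a a' b b' c c')
    (solve 6 (λ x x' y y' z z' →
        x :* (y' :+ z') :+ x' :* (y :+ z) := (x :* y' :+ x' :* y) :+ (x :* z' :+ x' :* z)) refl a a' b b' c c')

  distribʳ : ∀ x y z → (y +K z) *K x ≡ y *K x +K z *K x
  distribʳ x y z = trans (*-comm (y +K z) x) (trans (distribˡ x y z) (cong₂ _+K_ (*-comm x y) (*-comm x z)))

K-commutativeRing : CommutativeRing _ _
K-commutativeRing = record { isCommutativeRing = K-isCommutativeRing }

open CommutativeRing K-commutativeRing
  using (*-assoc; *-identityˡ; *-identityʳ; zeroˡ; zeroʳ; +-identityˡ; +-identityʳ;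
         semiring; *-commutativeSemigroup)
  renaming (_-_ to _-K_; -‿inverseʳ to -K‿inverseʳ)
open CommutativeSemigroupProperties *-commutativeSemigroup using (x∙yz≈y∙xz)
open RawSemiringDefinitions (Semiring.rawSemiring semiring) using (_^_)

module _ where
  open SemiringSum semiring using (sum; sum-cong-≗; ∑-comm; *-distribˡ-sum; *-distribʳ-sum)
  open ≡-Reasoning

  sumFin≡sum : ∀ {n} (f : Fin n → K) → sumFin f ≡ sum f
  sumFin≡sum {zero} f = refl
  sumFin≡sum {suc n} f = cong (f fz +K_) (sumFin≡sum (λ i → f (fs i)))

  sumFin-cong : ∀ {n} {f g : Fin n → K} → (∀ i → f i ≡ g i) → sumFin f ≡ sumFin g
  sumFin-cong {f = f} {g} f≗g = begin
    sumFin f ≡⟨ sumFin≡sum f ⟩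
    sum f    ≡⟨ sum-cong-≗ f≗g ⟩
    sum g    ≡⟨ sumFin≡sum g ⟨
    sumFin g ∎

  sumFin-comm : ∀ {m n} (f : Fin m → Fin n → K) →
    sumFin (λ i → sumFin (f i)) ≡ sumFin (λ j → sumFin (λ i → f i j))
  sumFin-comm f = begin
    sumFin (λ i → sumFin (f i))           ≡⟨ sumFin≡sum _ ⟩
    sum (λ i → sumFin (f i))              ≡⟨ sum-cong-≗ (λ i → sumFin≡sum (f i)) ⟩
    sum (λ i → sum (f i))                 ≡⟨ ∑-comm f ⟩
    sum (λ j → sum (λ i → f i j))         ≡⟨ sum-cong-≗ (λ j → sumFin≡sum (λ i → f i j)) ⟨
    sum (λ j → sumFin (λ i → f i j))      ≡⟨ sumFin≡sum _ ⟨
    sumFin (λ j → sumFin (λ i → f i j))   ∎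

  *-distribˡ-sumFin : ∀ {n} a (f : Fin n → K) → a *K sumFin f ≡ sumFin (λ i → a *K f i)
  *-distribˡ-sumFin a f = begin
    a *K sumFin f             ≡⟨ cong (a *K_) (sumFin≡sum f) ⟩
    a *K sum f                ≡⟨ *-distribˡ-sum a f ⟩
    sum (λ i → a *K f i)      ≡⟨ sumFin≡sum _ ⟨
    sumFin (λ i → a *K f i)   ∎

  *-distribʳ-sumFin : ∀ {n} a (f : Fin n → K) → sumFin f *K a ≡ sumFin (λ i → f i *K a)
  *-distribʳ-sumFin a f = begin
    sumFin f *K a             ≡⟨ cong (_*K a) (sumFin≡sum f) ⟩
    sum f *K a                ≡⟨ *-distribʳ-sum a f ⟩
    sum (λ i → f i *K a)      ≡⟨ sumFin≡sum _ ⟨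
    sumFin (λ i → f i *K a)   ∎

sumFin-zero : ∀ {n} {f : Fin n → K} → (∀ i → f i ≡ 0K) → sumFin f ≡ 0K
sumFin-zero {zero} f≡0 = refl
sumFin-zero {suc n} f≡0 = trans (cong₂ _+K_ (f≡0 fz) (sumFin-zero (λ i → f≡0 (fs i)))) (+-identityˡ 0K)

sumFin-single : ∀ {n} (f : Fin n → K) k → (∀ j → j ≢ k → f j ≡ 0K) → sumFin f ≡ f k
sumFin-single {suc n} f fz f≡0 =
  trans (cong (f fz +K_) (sumFin-zero (λ j → f≡0 (fs j) λ ()))) (+-identityʳ (f fz))
sumFin-single {suc n} f (fs k) f≡0 =
  trans (cong₂ _+K_ (f≡0 fz λ ()) (sumFin-single (λ j → f (fs j)) k λ j j≢k → f≡0 (fs j) (j≢k ∘′ suc-injective)))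
        (+-identityˡ (f (fs k)))

≈M-setoid : Setoid _ _
≈M-setoid = record
  { Carrier = Mat
  ; _≈_ = _≈M_
  ; isEquivalence = record
    { refl = λ _ _ → refl
    ; sym = λ p x y → sym (p x y)
    ; trans = λ p q x y → trans (p x y) (q x y) } }

open Setoid ≈M-setoid using () renaming (sym to ≈M-sym; trans to ≈M-trans)

infix 4 _≟M_
_≟M_ : Decidable _≈M_
M ≟M M' = all? (λ x → all? (λ y → M x y ≟K M' x y))

sumFinM-entry : ∀ {n} (G : Fin n → Mat) x y → sumFinM G x y ≡ sumFin (λ j → G j x y)
sumFinM-entry {zero} G x y = refl
sumFinM-entry {suc n} G x y = cong (G fz x y +K_) (sumFinM-entry (λ j → G (fs j)) x y)

sumFinM-single : ∀ {n} (G : Fin n → Mat) k → (∀ j → j ≢ k → G j ≈M zeroM) → sumFinM G ≈M G k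
sumFinM-single G k G≈0 x y =
  trans (sumFinM-entry G x y) (sumFin-single (λ j → G j x y) k (λ j j≢k → G≈0 j j≢k x y))

sumFinM-cong : ∀ {n} {G H : Fin n → Mat} → (∀ j → G j ≈M H j) → sumFinM G ≈M sumFinM H
sumFinM-cong {G = G} {H} G≈H x y = begin
  sumFinM G x y          ≡⟨ sumFinM-entry G x y ⟩
  sumFin (λ j → G j x y) ≡⟨ sumFin-cong (λ j → G≈H j x y) ⟩
  sumFin (λ j → H j x y) ≡⟨ sumFinM-entry H x y ⟨
  sumFinM H x y          ∎
  where open ≡-Reasoning

·s-cong : ∀ t {M M'} → M ≈M M' → t ·s M ≈M t ·s M'
·s-cong t M≈M' x y = cong (t *K_) (M≈M' x y)

∘M-cong : ∀ {M M' P P'} → M ≈M M' → P ≈M P' → M ∘M P ≈M M' ∘M P'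
∘M-cong M≈M' P≈P' x y = cong₂ _*K_ (M≈M' x y) (P≈P' x y)

·M-congˡ : ∀ M {P P'} → P ≈M P' → M ·M P ≈M M ·M P'
·M-congˡ M P≈P' x y = sumFin-cong (λ z → cong (M x z *K_) (P≈P' z y))

·M-congʳ : ∀ {M M'} → M ≈M M' → ∀ P → M ·M P ≈M M' ·M P
·M-congʳ M≈M' P x y = sumFin-cong (λ z → cong (_*K P z y) (M≈M' x z))

·M-assoc : ∀ M P Q → (M ·M P) ·M Q ≈M M ·M (P ·M Q)
·M-assoc M P Q x y = begin
  sumFin (λ z → sumFin (λ w → M x w *K P w z) *K Q z y)
    ≡⟨ sumFin-cong (λ z → trans (*-distribʳ-sumFin (Q z y) (λ w → M x w *K P w z))
                                 (sumFin-cong λ w → *-assoc (M x w) (P w z) (Q z y))) ⟩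
  sumFin (λ z → sumFin (λ w → M x w *K (P w z *K Q z y)))
    ≡⟨ sumFin-comm (λ z w → M x w *K (P w z *K Q z y)) ⟩
  sumFin (λ w → sumFin (λ z → M x w *K (P w z *K Q z y)))
    ≡⟨ sumFin-cong (λ w → *-distribˡ-sumFin (M x w) (λ z → P w z *K Q z y)) ⟨
  sumFin (λ w → M x w *K sumFin (λ z → P w z *K Q z y)) ∎
  where open ≡-Reasoning

·M-scalarˡ : ∀ t M P → (t ·s M) ·M P ≈M t ·s (M ·M P)
·M-scalarˡ t M P x y =
  trans (sumFin-cong (λ z → *-assoc t (M x z) (P z y))) (sym (*-distribˡ-sumFin t (λ z → M x z *K P z y)))

·M-scalarʳ : ∀ t M P → M ·M (t ·s P) ≈M t ·s (M ·M P)
·M-scalarʳ t M P x y =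
  trans (sumFin-cong (λ z → x∙yz≈y∙xz (M x z) t (P z y))) (sym (*-distribˡ-sumFin t (λ z → M x z *K P z y)))

·M-distribˡ-sumFinM : ∀ {n} M (G : Fin n → Mat) → M ·M sumFinM G ≈M sumFinM (λ j → M ·M G j)
·M-distribˡ-sumFinM M G x y = begin
  sumFin (λ z → M x z *K sumFinM G z y)
    ≡⟨ sumFin-cong (λ z → trans (cong (M x z *K_) (sumFinM-entry G z y)) (*-distribˡ-sumFin (M x z) (λ j → G j z y))) ⟩
  sumFin (λ z → sumFin (λ j → M x z *K G j z y))
    ≡⟨ sumFin-comm (λ z j → M x z *K G j z y) ⟩
  sumFin (λ j → (M ·M G j) x y)
    ≡⟨ sumFinM-entry (λ j → M ·M G j) x y ⟨
  sumFinM (λ j → M ·M G j) x y ∎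
  where open ≡-Reasoning

·M-distribʳ-sumFinM : ∀ {n} M (G : Fin n → Mat) → sumFinM G ·M M ≈M sumFinM (λ j → G j ·M M)
·M-distribʳ-sumFinM M G x y = begin
  sumFin (λ z → sumFinM G x z *K M z y)
    ≡⟨ sumFin-cong (λ z → trans (cong (_*K M z y) (sumFinM-entry G x z)) (*-distribʳ-sumFin (M z y) (λ j → G j x z))) ⟩
  sumFin (λ z → sumFin (λ j → G j x z *K M z y))
    ≡⟨ sumFin-comm (λ z j → G j x z *K M z y) ⟩
  sumFin (λ j → (G j ·M M) x y)
    ≡⟨ sumFinM-entry (λ j → G j ·M M) x y ⟨
  sumFinM (λ j → G j ·M M) x y ∎
  where open ≡-Reasoning

idM-diagonal : ∀ x → idM x x ≡ 1K
idM-diagonal x rewrite dec-true (x ≟ x) refl = refl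

idM-offDiagonal : ∀ {x y} → x ≢ y → idM x y ≡ 0K
idM-offDiagonal {x} {y} x≢y rewrite dec-false (x ≟ y) x≢y = refl

·M-identityˡ : ∀ M → idM ·M M ≈M M
·M-identityˡ M x y = begin
  sumFin (λ z → idM x z *K M z y)
    ≡⟨ sumFin-single _ x (λ z z≢x → trans (cong (_*K M z y) (idM-offDiagonal (z≢x ∘′ sym))) (zeroˡ (M z y))) ⟩
  idM x x *K M x y   ≡⟨ cong (_*K M x y) (idM-diagonal x) ⟩
  1K *K M x y        ≡⟨ *-identityˡ (M x y) ⟩
  M x y              ∎
  where open ≡-Reasoning

·M-identityʳ : ∀ M → M ·M idM ≈M M
·M-identityʳ M x y = begin
  sumFin (λ z → M x z *K idM z y)
    ≡⟨ sumFin-single _ y (λ z z≢y → trans (cong (M x z *K_) (idM-offDiagonal z≢y)) (zeroʳ (M x z))) ⟩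
  M x y *K idM y y   ≡⟨ cong (M x y *K_) (idM-diagonal y) ⟩
  M x y *K 1K        ≡⟨ *-identityʳ (M x y) ⟩
  M x y              ∎
  where open ≡-Reasoning

-- Eigenprojections are determined by their eigenvalues

Separated : K → K → Set
Separated a b = Σ[ w ∈ K ] w *K (a -K b) ≡ 1K

cancel-separated : ∀ a b p → Separated a b → a *K p ≡ b *K p → p ≡ 0K
cancel-separated a b p (w , w[a-b]≡1) ap≡bp = begin
  p                                ≡⟨ *-identityˡ p ⟨
  1K *K p                          ≡⟨ cong (_*K p) w[a-b]≡1 ⟨
  (w *K (a -K b)) *K p             ≡⟨ solve 4 (λ w a b p → (w :* (a :- b)) :* p := w :* (a :* p) :- w :* (b :* p))
                                            refl w a b p ⟩
  w *K (a *K p) -K w *K (b *K p)   ≡⟨ cong (λ t → w *K t -K w *K (b *K p)) ap≡bp ⟩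
  w *K (b *K p) -K w *K (b *K p)   ≡⟨ -K‿inverseʳ (w *K (b *K p)) ⟩
  0K                               ∎
  where
  open ≡-Reasoning
  open RingSolver (fromCommutativeRing K-commutativeRing) _≟K_

·M-eigen-orthogonal : ∀ (A P Q : Mat) (a b : K) → Separated a b →
  P ·M A ≈M a ·s P → A ·M Q ≈M b ·s Q → P ·M Q ≈M zeroM
·M-eigen-orthogonal A P Q a b separated PA≈aP AQ≈bQ x y =
  cancel-separated a b ((P ·M Q) x y) separated (aPQ≈bPQ x y)
  where
  open import Relation.Binary.Reasoning.Setoid ≈M-setoid
  aPQ≈bPQ : a ·s (P ·M Q) ≈M b ·s (P ·M Q)
  aPQ≈bPQ = begin
    a ·s (P ·M Q)    ≈⟨ ·M-scalarˡ a P Q ⟨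
    (a ·s P) ·M Q    ≈⟨ ·M-congʳ (≈M-sym PA≈aP) Q ⟩
    (P ·M A) ·M Q    ≈⟨ ·M-assoc P A Q ⟩
    P ·M (A ·M Q)    ≈⟨ ·M-congˡ P AQ≈bQ ⟩
    P ·M (b ·s Q)    ≈⟨ ·M-scalarʳ b P Q ⟩
    b ·s (P ·M Q)    ∎

module _ {n} {E : Fin n → Mat}
         (orthogonal : ∀ j k → E j ·M E k ≈M (if does (j ≟ k) then E k else zeroM))
         (complete : sumFinM E ≈M idM) where
  open import Relation.Binary.Reasoning.Setoid ≈M-setoid

  idempotent : ∀ k → E k ·M E k ≈M E k
  idempotent k with orthogonal k k
  ... | EkEk≈Ek rewrite dec-true (k ≟ k) refl = EkEk≈Ek

  orthogonal-≢ : ∀ {j k} → j ≢ k → E j ·M E k ≈M zeroM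
  orthogonal-≢ {j} {k} j≢k with orthogonal j k
  ... | EjEk≈0 rewrite dec-false (j ≟ k) j≢k = EjEk≈0

  left-eigen : ∀ (A : Mat) (θ : Fin n → K) → (∀ k → A ·M E k ≈M θ k ·s E k) → ∀ k → E k ·M A ≈M θ k ·s E k
  left-eigen A θ eigen k = begin
    E k ·M A                               ≈⟨ ·M-identityʳ (E k ·M A) ⟨
    (E k ·M A) ·M idM                      ≈⟨ ·M-congˡ (E k ·M A) complete ⟨
    (E k ·M A) ·M sumFinM E                ≈⟨ ·M-distribˡ-sumFinM (E k ·M A) E ⟩
    sumFinM (λ l → (E k ·M A) ·M E l)      ≈⟨ sumFinM-cong pull-eigenvalue ⟩
    sumFinM (λ l → θ l ·s (E k ·M E l))    ≈⟨ sumFinM-single (λ l → θ l ·s (E k ·M E l)) k off-diagonal ⟩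
    θ k ·s (E k ·M E k)                    ≈⟨ ·s-cong (θ k) (idempotent k) ⟩
    θ k ·s E k                             ∎
    where
    pull-eigenvalue : ∀ l → (E k ·M A) ·M E l ≈M θ l ·s (E k ·M E l)
    pull-eigenvalue l = begin
      (E k ·M A) ·M E l      ≈⟨ ·M-assoc (E k) A (E l) ⟩
      E k ·M (A ·M E l)      ≈⟨ ·M-congˡ (E k) (eigen l) ⟩
      E k ·M (θ l ·s E l)    ≈⟨ ·M-scalarʳ (θ l) (E k) (E l) ⟩
      θ l ·s (E k ·M E l)    ∎
    off-diagonal : ∀ l → l ≢ k → θ l ·s (E k ·M E l) ≈M zeroM
    off-diagonal l l≢k x y = trans (cong (θ l *K_) (orthogonal-≢ (l≢k ∘′ sym) x y)) (zeroʳ (θ l))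

  eigenprojections-unique : ∀ (A : Mat) (θ : Fin n → K) (F : Fin n → Mat) →
    (∀ j k → j ≢ k → Separated (θ j) (θ k)) →
    (∀ k → A ·M E k ≈M θ k ·s E k) →
    sumFinM F ≈M idM → (∀ k → A ·M F k ≈M θ k ·s F k) →
    ∀ k → E k ≈M F k
  eigenprojections-unique A θ F separated E-eigen F-complete F-eigen k = begin
    E k                          ≈⟨ ·M-identityʳ (E k) ⟨
    E k ·M idM                   ≈⟨ ·M-congˡ (E k) F-complete ⟨
    E k ·M sumFinM F             ≈⟨ ·M-distribˡ-sumFinM (E k) F ⟩
    sumFinM (λ j → E k ·M F j)   ≈⟨ sumFinM-single (λ j → E k ·M F j) k (λ j j≢k → EF≈0 (j≢k ∘′ sym)) ⟩
    E k ·M F k                   ≈⟨ sumFinM-single (λ j → E j ·M F k) k (λ j j≢k → EF≈0 j≢k) ⟨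
    sumFinM (λ j → E j ·M F k)   ≈⟨ ·M-distribʳ-sumFinM (F k) E ⟨
    sumFinM E ·M F k             ≈⟨ ·M-congʳ complete (F k) ⟩
    idM ·M F k                   ≈⟨ ·M-identityˡ (F k) ⟩
    F k                          ∎
    where
    EF≈0 : ∀ {i j} → i ≢ j → E i ·M F j ≈M zeroM
    EF≈0 {i} {j} i≢j = ·M-eigen-orthogonal A (E i) (F j) (θ i) (θ j) (separated i j i≢j)
                                           (left-eigen A θ E-eigen i) (F-eigen j)

DualPolynomialCondition : List ℕ² → (ℕ² → ℕ² → Set) → (ℕ² → Mat) → ℕ² → Set
DualPolynomialCondition D _≤_ E α = Σ (ℕ² → K) λ c →
  ¬ (c α ≡ 0K) × (∀ β → β ∈ D → ¬ (c β ≡ 0K) → β ≤ α) ×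
  (natK N ·s E α ≈M sumList D (λ β → c β ·s hmono (natK N ·s E ε₁) (natK N ·s E ε₂) β))

HadamardCondition : List ℕ² → (ℕ² → ℕ² → Set) → (ℕ² → Mat) → ℕ² → ℕ² → Set
HadamardCondition D _≤_ E i α = Σ (ℕ² → K) λ d →
  (∀ β → β ∈ D → ¬ (d β ≡ 0K) → β ≤ (α +² i)) ×
  (E i ∘M hmono (E ε₁) (E ε₂) α ≈M sumList D (λ β → d β ·s hmono (E ε₁) (E ε₂) β))

hpow-cong : ∀ {M M'} → M ≈M M' → ∀ n → hpow M n ≈M hpow M' n
hpow-cong M≈M' zero = λ _ _ → refl
hpow-cong M≈M' (suc n) = ∘M-cong M≈M' (hpow-cong M≈M' n)

hmono-cong : ∀ {M₁ M₁' M₂ M₂'} → M₁ ≈M M₁' → M₂ ≈M M₂' → ∀ β → hmono M₁ M₂ β ≈M hmono M₁' M₂' β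
hmono-cong M₁≈M₁' M₂≈M₂' (n₁ , n₂) = ∘M-cong (hpow-cong M₁≈M₁' n₁) (hpow-cong M₂≈M₂' n₂)

sumList-cong : ∀ D {f g : ℕ² → Mat} → (∀ β → f β ≈M g β) → sumList D f ≈M sumList D g
sumList-cong [] f≈g x y = refl
sumList-cong (β ∷ D) f≈g x y = cong₂ _+K_ (f≈g β x y) (sumList-cong D f≈g x y)

module _ {D : List ℕ²} {_≤_ : ℕ² → ℕ² → Set} {E E' : ℕ² → Mat} (E≈E' : ∀ α → E α ≈M E' α) where
  open import Relation.Binary.Reasoning.Setoid ≈M-setoid

  dualPolynomialCondition-cong : ∀ α → DualPolynomialCondition D _≤_ E α → DualPolynomialCondition D _≤_ E' α
  dualPolynomialCondition-cong α (c , c≢0 , support , identity) = c , c≢0 , support , (begin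
    natK N ·s E' α                                                      ≈⟨ N·E≈N·E' α ⟨
    natK N ·s E α                                                       ≈⟨ identity ⟩
    sumList D (λ β → c β ·s hmono (natK N ·s E ε₁) (natK N ·s E ε₂) β)
      ≈⟨ sumList-cong D (λ β → ·s-cong (c β) (hmono-cong (N·E≈N·E' ε₁) (N·E≈N·E' ε₂) β)) ⟩
    sumList D (λ β → c β ·s hmono (natK N ·s E' ε₁) (natK N ·s E' ε₂) β) ∎)
    where
    N·E≈N·E' : ∀ α → natK N ·s E α ≈M natK N ·s E' α
    N·E≈N·E' α = ·s-cong (natK N) (E≈E' α)

  hadamardCondition-cong : ∀ i α → HadamardCondition D _≤_ E i α → HadamardCondition D _≤_ E' i α
  hadamardCondition-cong i α (d , support , identity) = d , support , (begin
    E' i ∘M hmono (E' ε₁) (E' ε₂) α                   ≈⟨ ∘M-cong (E≈E' i) (hmono-cong (E≈E' ε₁) (E≈E' ε₂) α) ⟨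
    E i ∘M hmono (E ε₁) (E ε₂) α                      ≈⟨ identity ⟩
    sumList D (λ β → d β ·s hmono (E ε₁) (E ε₂) β)    ≈⟨ sumList-cong D (λ β → ·s-cong (d β) (hmono-cong (E≈E' ε₁) (E≈E' ε₂) β)) ⟩
    sumList D (λ β → d β ·s hmono (E' ε₁) (E' ε₂) β)  ∎)

  isBivariateQPolynomial-cong : IsBivariateQPolynomial D _≤_ E → IsBivariateQPolynomial D _≤_ E'
  isBivariateQPolynomial-cong (ε₁∈D , ε₂∈D , downClosed , dual , hadamard) =
    ε₁∈D , ε₂∈D , downClosed ,
    (λ α α∈D → dualPolynomialCondition-cong α (dual α α∈D)) ,
    (λ i i∈ε α α∈D → hadamardCondition-cong i α (hadamard i i∈ε α α∈D))

relabel-cong : ∀ {E F : Fin 6 → Mat} → (∀ k → E k ≈M F k) → ∀ α → relabel E α ≈M relabel F α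
relabel-cong E≈F (0 , 0) = E≈F 0F
relabel-cong E≈F (0 , 1) = E≈F 1F
relabel-cong E≈F (0 , 2) = E≈F 2F
relabel-cong E≈F (1 , 0) = E≈F 3F
relabel-cong E≈F (1 , 1) = E≈F 4F
relabel-cong E≈F (0 , 3) = E≈F 5F
relabel-cong E≈F (0 , suc (suc (suc (suc _)))) = λ _ _ → refl
relabel-cong E≈F (1 , suc (suc _)) = λ _ _ → refl
relabel-cong E≈F (suc (suc _) , _) = λ _ _ → refl

module Profiles {C : Set} (class : X → X → C) where
  infix 4 _hasProfile_
  record _hasProfile_ (M : Mat) (m : C → K) : Set where
    constructor profile
    field entry : ∀ x y → M x y ≡ m (class x y)
  open _hasProfile_

  monomial : K → K → ℕ² → K
  monomial a b (n₁ , n₂) = a ^ n₁ *K b ^ n₂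

  sumOver : List ℕ² → (ℕ² → K) → K
  sumOver D g = foldr (λ β s → g β +K s) 0K D

  ·s-profile : ∀ t {M m} → M hasProfile m → t ·s M hasProfile (λ c → t *K m c)
  ·s-profile t M~m = profile λ x y → cong (t *K_) (entry M~m x y)

  ∘M-profile : ∀ {M P m p} → M hasProfile m → P hasProfile p → M ∘M P hasProfile (λ c → m c *K p c)
  ∘M-profile M~m P~p = profile λ x y → cong₂ _*K_ (entry M~m x y) (entry P~p x y)

  hpow-profile : ∀ {M m} → M hasProfile m → ∀ n → hpow M n hasProfile (λ c → m c ^ n)
  hpow-profile M~m zero = profile λ x y → refl
  hpow-profile M~m (suc n) = ∘M-profile M~m (hpow-profile M~m n)

  hmono-profile : ∀ {M₁ M₂ m₁ m₂} → M₁ hasProfile m₁ → M₂ hasProfile m₂ →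
    ∀ β → hmono M₁ M₂ β hasProfile (λ c → monomial (m₁ c) (m₂ c) β)
  hmono-profile M₁~m₁ M₂~m₂ (n₁ , n₂) = ∘M-profile (hpow-profile M₁~m₁ n₁) (hpow-profile M₂~m₂ n₂)

  sumList-profile : ∀ D {f : ℕ² → Mat} {g : ℕ² → C → K} → (∀ β → f β hasProfile g β) →
    sumList D f hasProfile (λ c → sumOver D (λ β → g β c))
  sumList-profile [] f~g = profile λ x y → refl
  sumList-profile (β ∷ D) f~g = profile λ x y → cong₂ _+K_ (entry (f~g β) x y) (entry (sumList-profile D f~g) x y)

  ≈M-fromProfiles : ∀ {M M' m m'} → M hasProfile m → M' hasProfile m' → (∀ c → m c ≡ m' c) → M ≈M M'
  ≈M-fromProfiles M~m M'~m' m≗m' x y = trans (entry M~m x y) (trans (m≗m' (class x y)) (sym (entry M'~m' x y)))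

-- Numeric literals are overloaded only from here on, since the ring solver above
-- needs plain ℕ literals; tt is the instance discharging their side conditions.
open import Agda.Builtin.FromNat using (Number; fromNat)
open import Agda.Builtin.FromNeg using (Negative; fromNeg)
import Data.Nat.Literals as ℕ
import Data.Integer.Literals as ℤ
open import Data.Unit using (tt)

instance
  ℕ-number : Number ℕ
  ℕ-number = ℕ.number
  ℤ-number : Number ℤ
  ℤ-number = ℤ.number
  ℤ-negative : Negative ℤ
  ℤ-negative = ℤ.negative

infix 6 [_+_√5]/_ _/K_
[_+_√5]/_ : ℤ → ℤ → (d : ℕ) .{{_ : ℕ.NonZero d}} → K
[ a + b √5]/ d = (a / d) +√5· (b / d)

_/K_ : ℤ → (d : ℕ) .{{_ : ℕ.NonZero d}} → K
a /K d = (a / d) +√5· 0ℚ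

-- Not assumed to list graph distances: the matrices F built from it are
-- certified directly against A 1 below.
distanceTable : Vec (Vec (Fin 6) 20) 20
distanceTable =
  (0F ∷ 1F ∷ 2F ∷ 3F ∷ 4F ∷ 5F ∷ 4F ∷ 3F ∷ 2F ∷ 1F ∷ 1F ∷ 2F ∷ 2F ∷ 3F ∷ 3F ∷ 4F ∷ 3F ∷ 3F ∷ 2F ∷ 2F ∷ [])
  ∷ (1F ∷ 0F ∷ 1F ∷ 2F ∷ 3F ∷ 4F ∷ 5F ∷ 4F ∷ 3F ∷ 2F ∷ 2F ∷ 1F ∷ 2F ∷ 2F ∷ 3F ∷ 3F ∷ 4F ∷ 3F ∷ 3F ∷ 2F ∷ [])
  ∷ (2F ∷ 1F ∷ 0F ∷ 1F ∷ 2F ∷ 3F ∷ 4F ∷ 5F ∷ 4F ∷ 3F ∷ 2F ∷ 2F ∷ 1F ∷ 2F ∷ 2F ∷ 3F ∷ 3F ∷ 4F ∷ 3F ∷ 3F ∷ [])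
  ∷ (3F ∷ 2F ∷ 1F ∷ 0F ∷ 1F ∷ 2F ∷ 3F ∷ 4F ∷ 5F ∷ 4F ∷ 3F ∷ 2F ∷ 2F ∷ 1F ∷ 2F ∷ 2F ∷ 3F ∷ 3F ∷ 4F ∷ 3F ∷ [])
  ∷ (4F ∷ 3F ∷ 2F ∷ 1F ∷ 0F ∷ 1F ∷ 2F ∷ 3F ∷ 4F ∷ 5F ∷ 3F ∷ 3F ∷ 2F ∷ 2F ∷ 1F ∷ 2F ∷ 2F ∷ 3F ∷ 3F ∷ 4F ∷ [])
  ∷ (5F ∷ 4F ∷ 3F ∷ 2F ∷ 1F ∷ 0F ∷ 1F ∷ 2F ∷ 3F ∷ 4F ∷ 4F ∷ 3F ∷ 3F ∷ 2F ∷ 2F ∷ 1F ∷ 2F ∷ 2F ∷ 3F ∷ 3F ∷ [])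
  ∷ (4F ∷ 5F ∷ 4F ∷ 3F ∷ 2F ∷ 1F ∷ 0F ∷ 1F ∷ 2F ∷ 3F ∷ 3F ∷ 4F ∷ 3F ∷ 3F ∷ 2F ∷ 2F ∷ 1F ∷ 2F ∷ 2F ∷ 3F ∷ [])
  ∷ (3F ∷ 4F ∷ 5F ∷ 4F ∷ 3F ∷ 2F ∷ 1F ∷ 0F ∷ 1F ∷ 2F ∷ 3F ∷ 3F ∷ 4F ∷ 3F ∷ 3F ∷ 2F ∷ 2F ∷ 1F ∷ 2F ∷ 2F ∷ [])
  ∷ (2F ∷ 3F ∷ 4F ∷ 5F ∷ 4F ∷ 3F ∷ 2F ∷ 1F ∷ 0F ∷ 1F ∷ 2F ∷ 3F ∷ 3F ∷ 4F ∷ 3F ∷ 3F ∷ 2F ∷ 2F ∷ 1F ∷ 2F ∷ [])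
  ∷ (1F ∷ 2F ∷ 3F ∷ 4F ∷ 5F ∷ 4F ∷ 3F ∷ 2F ∷ 1F ∷ 0F ∷ 2F ∷ 2F ∷ 3F ∷ 3F ∷ 4F ∷ 3F ∷ 3F ∷ 2F ∷ 2F ∷ 1F ∷ [])
  ∷ (1F ∷ 2F ∷ 2F ∷ 3F ∷ 3F ∷ 4F ∷ 3F ∷ 3F ∷ 2F ∷ 2F ∷ 0F ∷ 3F ∷ 1F ∷ 4F ∷ 2F ∷ 5F ∷ 2F ∷ 4F ∷ 1F ∷ 3F ∷ [])
  ∷ (2F ∷ 1F ∷ 2F ∷ 2F ∷ 3F ∷ 3F ∷ 4F ∷ 3F ∷ 3F ∷ 2F ∷ 3F ∷ 0F ∷ 3F ∷ 1F ∷ 4F ∷ 2F ∷ 5F ∷ 2F ∷ 4F ∷ 1F ∷ [])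
  ∷ (2F ∷ 2F ∷ 1F ∷ 2F ∷ 2F ∷ 3F ∷ 3F ∷ 4F ∷ 3F ∷ 3F ∷ 1F ∷ 3F ∷ 0F ∷ 3F ∷ 1F ∷ 4F ∷ 2F ∷ 5F ∷ 2F ∷ 4F ∷ [])
  ∷ (3F ∷ 2F ∷ 2F ∷ 1F ∷ 2F ∷ 2F ∷ 3F ∷ 3F ∷ 4F ∷ 3F ∷ 4F ∷ 1F ∷ 3F ∷ 0F ∷ 3F ∷ 1F ∷ 4F ∷ 2F ∷ 5F ∷ 2F ∷ [])
  ∷ (3F ∷ 3F ∷ 2F ∷ 2F ∷ 1F ∷ 2F ∷ 2F ∷ 3F ∷ 3F ∷ 4F ∷ 2F ∷ 4F ∷ 1F ∷ 3F ∷ 0F ∷ 3F ∷ 1F ∷ 4F ∷ 2F ∷ 5F ∷ [])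
  ∷ (4F ∷ 3F ∷ 3F ∷ 2F ∷ 2F ∷ 1F ∷ 2F ∷ 2F ∷ 3F ∷ 3F ∷ 5F ∷ 2F ∷ 4F ∷ 1F ∷ 3F ∷ 0F ∷ 3F ∷ 1F ∷ 4F ∷ 2F ∷ [])
  ∷ (3F ∷ 4F ∷ 3F ∷ 3F ∷ 2F ∷ 2F ∷ 1F ∷ 2F ∷ 2F ∷ 3F ∷ 2F ∷ 5F ∷ 2F ∷ 4F ∷ 1F ∷ 3F ∷ 0F ∷ 3F ∷ 1F ∷ 4F ∷ [])
  ∷ (3F ∷ 3F ∷ 4F ∷ 3F ∷ 3F ∷ 2F ∷ 2F ∷ 1F ∷ 2F ∷ 2F ∷ 4F ∷ 2F ∷ 5F ∷ 2F ∷ 4F ∷ 1F ∷ 3F ∷ 0F ∷ 3F ∷ 1F ∷ [])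
  ∷ (2F ∷ 3F ∷ 3F ∷ 4F ∷ 3F ∷ 3F ∷ 2F ∷ 2F ∷ 1F ∷ 2F ∷ 1F ∷ 4F ∷ 2F ∷ 5F ∷ 2F ∷ 4F ∷ 1F ∷ 3F ∷ 0F ∷ 3F ∷ [])
  ∷ (2F ∷ 2F ∷ 3F ∷ 3F ∷ 4F ∷ 3F ∷ 3F ∷ 2F ∷ 2F ∷ 1F ∷ 3F ∷ 1F ∷ 4F ∷ 2F ∷ 5F ∷ 2F ∷ 4F ∷ 1F ∷ 3F ∷ 0F ∷ [])
  ∷ []

distance : X → X → Fin 6
distance x y = lookup (lookup distanceTable x) y

idempotentRow : ℕ² → Vec K 6
idempotentRow (0 , 0) = 3 /K 60 ∷ 3 /K 60 ∷ 3 /K 60 ∷ 3 /K 60 ∷ 3 /K 60 ∷ 3 /K 60 ∷ []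
idempotentRow (0 , 1) = 9 /K 60 ∷ [ 0 + 3 √5]/ 60 ∷ 3 /K 60 ∷ -3 /K 60 ∷ [ 0 + -3 √5]/ 60 ∷ -9 /K 60 ∷ []
idempotentRow (0 , 2) = 15 /K 60 ∷ 5 /K 60 ∷ -5 /K 60 ∷ -5 /K 60 ∷ 5 /K 60 ∷ 15 /K 60 ∷ []
idempotentRow (1 , 0) = 12 /K 60 ∷ 0 /K 60 ∷ -6 /K 60 ∷ 6 /K 60 ∷ 0 /K 60 ∷ -12 /K 60 ∷ []
idempotentRow (1 , 1) = 12 /K 60 ∷ -8 /K 60 ∷ 2 /K 60 ∷ 2 /K 60 ∷ -8 /K 60 ∷ 12 /K 60 ∷ []
idempotentRow (0 , 3) = 9 /K 60 ∷ [ 0 + -3 √5]/ 60 ∷ 3 /K 60 ∷ -3 /K 60 ∷ [ 0 + 3 √5]/ 60 ∷ -9 /K 60 ∷ []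
idempotentRow _ = replicate 6 0K

idempotentEntry : ℕ² → Fin 6 → K
idempotentEntry α = lookup (idempotentRow α)

label : Fin 6 → ℕ²
label 0F = (0 , 0)
label 1F = (0 , 1)
label 2F = (0 , 2)
label 3F = (1 , 0)
label 4F = (1 , 1)
label 5F = (0 , 3)

F : Fin 6 → Mat
F k x y = idempotentEntry (label k) (distance x y)

F-complete : sumFinM F ≈M idM
F-complete = from-yes (sumFinM F ≟M idM)

-- A 1 is defined through walks and is slow to evaluate, so the eigenvalue equations
-- are checked for the adjacency matrix instead.
adjacency : Mat
adjacency x y = if adj x y then 1K else 0K

A₁≈adjacency : A 1 ≈M adjacency
A₁≈adjacency = from-yes (A 1 ≟M adjacency)

adjacency-eigen : ∀ k → adjacency ·M F k ≈M θ k ·s F k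
adjacency-eigen = from-yes (all? λ k → adjacency ·M F k ≟M θ k ·s F k)

A₁-eigen : ∀ k → A 1 ·M F k ≈M θ k ·s F k
A₁-eigen k = ≈M-trans (·M-congʳ A₁≈adjacency (F k)) (adjacency-eigen k)

θ-gap⁻¹ : Fin 6 → Fin 6 → K
θ-gap⁻¹ j k = lookup (lookup table j) k
  where
  table : Vec (Vec K 6) 6
  table =
    (0K ∷ [ 3 + 1 √5]/ 4 ∷ 1 /K 2 ∷ 1 /K 3 ∷ 1 /K 5 ∷ [ 3 + -1 √5]/ 4 ∷ [])
    ∷ ([ -3 + -1 √5]/ 4 ∷ 0K ∷ [ 1 + 1 √5]/ 4 ∷ [ 0 + 1 √5]/ 5 ∷ [ -2 + 1 √5]/ 1 ∷ [ 0 + 1 √5]/ 10 ∷ [])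
    ∷ (-1 /K 2 ∷ [ -1 + -1 √5]/ 4 ∷ 0K ∷ 1 /K 1 ∷ 1 /K 3 ∷ [ -1 + 1 √5]/ 4 ∷ [])
    ∷ (-1 /K 3 ∷ [ 0 + -1 √5]/ 5 ∷ -1 /K 1 ∷ 0K ∷ 1 /K 2 ∷ [ 0 + 1 √5]/ 5 ∷ [])
    ∷ (-1 /K 5 ∷ [ 2 + -1 √5]/ 1 ∷ -1 /K 3 ∷ -1 /K 2 ∷ 0K ∷ [ 2 + 1 √5]/ 1 ∷ [])
    ∷ ([ -3 + 1 √5]/ 4 ∷ [ 0 + -1 √5]/ 10 ∷ [ 1 + -1 √5]/ 4 ∷ [ 0 + -1 √5]/ 5 ∷ [ -2 + -1 √5]/ 1 ∷ 0K ∷ [])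
    ∷ []

θ-separated : ∀ j k → j ≢ k → Separated (θ j) (θ k)
θ-separated j k j≢k
  with from-yes (all? λ j → all? λ k → (j ≟ k) ⊎-dec (θ-gap⁻¹ j k *K (θ j -K θ k) ≟K 1K)) j k
... | inj₁ j≡k = ⊥-elim (j≢k j≡k)
... | inj₂ inverse = θ-gap⁻¹ j k , inverse

open Profiles distance

infix 4 _≤grlex?_
_≤grlex?_ : Decidable _≤grlex_
(a₁ , a₂) ≤grlex? (b₁ , b₂) =
  (a₁ ℕ.+ a₂ ℕ.<? b₁ ℕ.+ b₂) ⊎-dec
  ((a₁ ℕ.+ a₂ ℕ.≟ b₁ ℕ.+ b₂) ×-dec
    (≡-dec ℕ._≟_ ℕ._≟_ (a₁ , a₂) (b₁ , b₂) ⊎-dec (a₁ ℕ.<? b₁) ⊎-dec ((a₁ ℕ.≟ b₁) ×-dec (a₂ ℕ.<? b₂))))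

ε₁∈Dstar : ε₁ ∈ Dstar
ε₁∈Dstar = from-yes (ε₁ ∈? Dstar)

ε₂∈Dstar : ε₂ ∈ Dstar
ε₂∈Dstar = from-yes (ε₂ ∈? Dstar)

Dstar-downClosed : ∀ n₁ n₂ m₁ m₂ → (n₁ , n₂) ∈ Dstar → m₁ ℕ.≤ n₁ → m₂ ℕ.≤ n₂ → (m₁ , m₂) ∈ Dstar
Dstar-downClosed n₁ n₂ m₁ m₂ n∈D m₁≤n₁ m₂≤n₂ = All.lookup downsets n∈D (s≤s m₁≤n₁) (s≤s m₂≤n₂)
  where
  downsets : All (λ (n₁ , n₂) → ∀ {m₁} → m₁ ℕ.< suc n₁ → ∀ {m₂} → m₂ ℕ.< suc n₂ → (m₁ , m₂) ∈ Dstar) Dstar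
  downsets = from-yes (All.all? (λ (n₁ , n₂) →
    allUpTo? (λ m₁ → allUpTo? (λ m₂ → (m₁ , m₂) ∈? Dstar) (suc n₂)) (suc n₁)) Dstar)

SupportedBelow : (ℕ² → K) → ℕ² → Set
SupportedBelow c γ = All (λ β → c β ≡ 0K ⊎ β ≤grlex γ) Dstar

supportedBelow? : ∀ c γ → Dec (SupportedBelow c γ)
supportedBelow? c γ = All.all? (λ β → (c β ≟K 0K) ⊎-dec (β ≤grlex? γ)) Dstar

supportedBelow⇒ : ∀ {c γ} → SupportedBelow c γ → ∀ β → β ∈ Dstar → ¬ (c β ≡ 0K) → β ≤grlex γ
supportedBelow⇒ support β β∈D cβ≢0 with All.lookup support β∈D
... | inj₁ cβ≡0 = ⊥-elim (cβ≢0 cβ≡0)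
... | inj₂ β≤γ = β≤γ

relabel-F-profile : ∀ {α} → α ∈ Dstar → relabel F α hasProfile idempotentEntry α
relabel-F-profile (here refl) = profile λ x y → refl
relabel-F-profile (there (here refl)) = profile λ x y → refl
relabel-F-profile (there (there (here refl))) = profile λ x y → refl
relabel-F-profile (there (there (there (here refl)))) = profile λ x y → refl
relabel-F-profile (there (there (there (there (here refl))))) = profile λ x y → refl
relabel-F-profile (there (there (there (there (there (here refl)))))) = profile λ x y → refl

E₁-profile : relabel F ε₁ hasProfile idempotentEntry ε₁
E₁-profile = relabel-F-profile ε₁∈Dstar

E₂-profile : relabel F ε₂ hasProfile idempotentEntry ε₂
E₂-profile = relabel-F-profile ε₂∈Dstar

dualPolynomial : ℕ² → ℕ² → K
dualPolynomial (0 , 0) (0 , 0) = 1 /K 1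
dualPolynomial (0 , 1) (0 , 1) = 1 /K 1
dualPolynomial (0 , 2) (0 , 0) = -5 /K 2
dualPolynomial (0 , 2) (0 , 2) = 5 /K 6
dualPolynomial (0 , 3) (0 , 1) = -27 /K 2
dualPolynomial (0 , 3) (0 , 3) = 5 /K 2
dualPolynomial (0 , 3) (1 , 0) = -6 /K 1
dualPolynomial (1 , 0) (1 , 0) = 1 /K 1
dualPolynomial (1 , 1) (0 , 0) = 4 /K 1
dualPolynomial (1 , 1) (0 , 2) = -4 /K 3
dualPolynomial (1 , 1) (1 , 1) = 1 /K 1
dualPolynomial _ _ = 0K

DualPolynomialCertificate : ℕ² → Set
DualPolynomialCertificate α =
  ¬ (dualPolynomial α α ≡ 0K) × SupportedBelow (dualPolynomial α) α ×
  (∀ c → natK N *K idempotentEntry α c ≡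
         sumOver Dstar (λ β → dualPolynomial α β *K
                                monomial (natK N *K idempotentEntry ε₁ c) (natK N *K idempotentEntry ε₂ c) β))

dualPolynomialCertificates : All DualPolynomialCertificate Dstar
dualPolynomialCertificates = from-yes (All.all? (λ α →
  ¬? (dualPolynomial α α ≟K 0K) ×-dec supportedBelow? (dualPolynomial α) α ×-dec
  all? (λ c → natK N *K idempotentEntry α c ≟K
              sumOver Dstar (λ β → dualPolynomial α β *K
                                     monomial (natK N *K idempotentEntry ε₁ c) (natK N *K idempotentEntry ε₂ c) β))) Dstar)

dualPolynomialCondition : ∀ {α} → α ∈ Dstar → DualPolynomialCertificate α →
  DualPolynomialCondition Dstar _≤grlex_ (relabel F) α
dualPolynomialCondition {α} α∈D (leading≢0 , support , identity) =
  dualPolynomial α , leading≢0 , supportedBelow⇒ support ,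
  ≈M-fromProfiles (·s-profile (natK N) (relabel-F-profile α∈D))
                  (sumList-profile Dstar λ β → ·s-profile (dualPolynomial α β)
                     (hmono-profile (·s-profile (natK N) E₁-profile) (·s-profile (natK N) E₂-profile) β))
                  identity

-- hadamardCoefficient i α expresses E_i ∘ E^{∘α} in terms of the E^{∘β}; found by
-- solving the linear system on the six distance classes.
hadamardCoefficient : ℕ² → ℕ² → ℕ² → K
hadamardCoefficient (1 , 0) (0 , 0) (1 , 0) = 1 /K 1
hadamardCoefficient (1 , 0) (0 , 1) (1 , 1) = 1 /K 1
hadamardCoefficient (1 , 0) (0 , 2) (0 , 1) = -1 /K 10
hadamardCoefficient (1 , 0) (0 , 2) (0 , 3) = 8 /K 1
hadamardCoefficient (1 , 0) (0 , 2) (1 , 0) = -3 /K 80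
hadamardCoefficient (1 , 0) (0 , 3) (0 , 0) = 3 /K 20000
hadamardCoefficient (1 , 0) (0 , 3) (0 , 2) = -3 /K 250
hadamardCoefficient (1 , 0) (0 , 3) (1 , 1) = 53 /K 2000
hadamardCoefficient (1 , 0) (1 , 0) (0 , 0) = 1 /K 40
hadamardCoefficient (1 , 0) (1 , 0) (0 , 2) = -2 /K 1
hadamardCoefficient (1 , 0) (1 , 0) (1 , 1) = 2 /K 1
hadamardCoefficient (1 , 0) (1 , 1) (0 , 1) = -7 /K 40
hadamardCoefficient (1 , 0) (1 , 1) (0 , 3) = 14 /K 1
hadamardCoefficient (1 , 0) (1 , 1) (1 , 0) = -3 /K 40
hadamardCoefficient (0 , 1) (0 , 0) (0 , 1) = 1 /K 1
hadamardCoefficient (0 , 1) (0 , 1) (0 , 2) = 1 /K 1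
hadamardCoefficient (0 , 1) (0 , 2) (0 , 3) = 1 /K 1
hadamardCoefficient (0 , 1) (0 , 3) (0 , 0) = 3 /K 160000
hadamardCoefficient (0 , 1) (0 , 3) (0 , 2) = 11 /K 1000
hadamardCoefficient (0 , 1) (0 , 3) (1 , 1) = 1 /K 125
hadamardCoefficient (0 , 1) (1 , 0) (1 , 1) = 1 /K 1
hadamardCoefficient (0 , 1) (1 , 1) (0 , 1) = -1 /K 10
hadamardCoefficient (0 , 1) (1 , 1) (0 , 3) = 8 /K 1
hadamardCoefficient (0 , 1) (1 , 1) (1 , 0) = -3 /K 80
hadamardCoefficient _ _ _ = 0K

HadamardCertificate : ℕ² → ℕ² → Set
HadamardCertificate i α =
  SupportedBelow (hadamardCoefficient i α) (α +² i) ×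
  (∀ c → idempotentEntry i c *K monomial (idempotentEntry ε₁ c) (idempotentEntry ε₂ c) α ≡
         sumOver Dstar (λ β → hadamardCoefficient i α β *K monomial (idempotentEntry ε₁ c) (idempotentEntry ε₂ c) β))

hadamardCertificate? : ∀ i α → Dec (HadamardCertificate i α)
hadamardCertificate? i α =
  supportedBelow? (hadamardCoefficient i α) (α +² i) ×-dec
  all? (λ c → idempotentEntry i c *K monomial (idempotentEntry ε₁ c) (idempotentEntry ε₂ c) α ≟K
              sumOver Dstar (λ β → hadamardCoefficient i α β *K monomial (idempotentEntry ε₁ c) (idempotentEntry ε₂ c) β))

hadamardCertificates : All (λ α → HadamardCertificate ε₁ α × HadamardCertificate ε₂ α) Dstar
hadamardCertificates = from-yes (All.all? (λ α → hadamardCertificate? ε₁ α ×-dec hadamardCertificate? ε₂ α) Dstar)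

hadamardCondition : ∀ {i α} → i ∈ Dstar → α ∈ Dstar → HadamardCertificate i α →
  HadamardCondition Dstar _≤grlex_ (relabel F) i α
hadamardCondition {i} {α} i∈D α∈D (support , identity) =
  hadamardCoefficient i α , supportedBelow⇒ support ,
  ≈M-fromProfiles (∘M-profile (relabel-F-profile i∈D) (hmono-profile E₁-profile E₂-profile α))
                  (sumList-profile Dstar λ β → ·s-profile (hadamardCoefficient i α β) (hmono-profile E₁-profile E₂-profile β))
                  identity

F-isBivariateQPolynomial : IsBivariateQPolynomial Dstar _≤grlex_ (relabel F)
F-isBivariateQPolynomial = ε₁∈Dstar , ε₂∈Dstar , Dstar-downClosed , dual , hadamard
  where
  dual : ∀ α → α ∈ Dstar → DualPolynomialCondition Dstar _≤grlex_ (relabel F) α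
  dual α α∈D = dualPolynomialCondition α∈D (All.lookup dualPolynomialCertificates α∈D)

  hadamard : ∀ i → (i ≡ ε₁ ⊎ i ≡ ε₂) → ∀ α → α ∈ Dstar → HadamardCondition Dstar _≤grlex_ (relabel F) i α
  hadamard i (inj₁ refl) α α∈D = hadamardCondition ε₁∈Dstar α∈D (proj₁ (All.lookup hadamardCertificates α∈D))
  hadamard i (inj₂ refl) α α∈D = hadamardCondition ε₂∈Dstar α∈D (proj₂ (All.lookup hadamardCertificates α∈D))

mainTheorem2 : (E : Fin 6 → Mat) → IsPrimitiveIdempotents E →
    (∀ k → A 1 ·M E k ≈M θ k ·s E k) →
    IsBivariateQPolynomial Dstar _≤grlex_ (relabel E)
mainTheorem2 E (_ , _ , orthogonal , complete) E-eigen =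
  isBivariateQPolynomial-cong (relabel-cong F≈E) F-isBivariateQPolynomial
  where
  E≈F : ∀ k → E k ≈M F k
  E≈F = eigenprojections-unique orthogonal complete (A 1) θ F θ-separated E-eigen F-complete A₁-eigen

  F≈E : ∀ k → F k ≈M E k
  F≈E k = ≈M-sym (E≈F k)
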